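{- Let $p$ be a prime and $q=p^m$ for a positive integer $m$. Let $J=\{x^q-x: x\in\mathbb{F}_{q^2}\}$, let $g\in\mathbb{F}_{q^2}[x]$ satisfy $g(J)\subseteq J$, let $\phi(x)=\sum_i a_ix^{q^i}$ with all $a_i\in\mathbb{F}_q$, let $s\in\{p^h+p^k: 1\le h\le k\le 2m-1\}$ and $b\in\mathbb{F}_q^*$, and put $f(x)=b\phi(x)+(g(x^q-x))^s$. If $f$ is a permutation polynomial of $\mathbb{F}_{q^2}$, then $f$ is PcN over $\mathbb{F}_{q^2}$ for every $c\in\mathbb{F}_q\setminus\{1\}$.
   Context: For $f:\mathbb{F}_{Q}\to\mathbb{F}_{Q}$ and $c\in\mathbb{F}_Q$, ${}_c\Delta_f(a,b)=\#\{x\in\mathbb{F}_Q: f(x+a)-cf(x)=b\}$ and ${}_c\Delta_f=\max\{{}_c\Delta_f(a,b): a,b\in\mathbb{F}_Q,\ (a,c)\neq(0,1)\}$; $f$ is PcN if ${}_c\Delta_f\le 1$. -}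

module Defs where

open import Level using (0ℓ)
open import Data.Nat as ℕ using (ℕ; zero; suc)
open import Data.Fin using (Fin)
open import Data.Fin.Properties using () renaming (_≟_ to _≟ᶠ_)
open import Data.List using (List; []; _∷_; length; filter)
open import Data.List.Base using ()
open import Data.Product using (∃; _×_; _,_)
open import Data.Vec.Functional using ()
open import Data.Fin using (Fin)
open import Data.List using (List)
open import Data.List.Base using ()
open import Algebra.Core using (Op₁; Op₂)
open import Algebra.Structures using (IsCommutativeRing)
open import Function.Bundles using (Inverse; _↔_)
open import Function.Definitions using (Bijective)
open import Relation.Nullary using (¬_; Dec; yes; no)
open import Relation.Nullary.Decidable using (map′)
open import Relation.Binary.PropositionalEquality using (_≡_; _≢_; cong; refl; sym; trans)
import Data.List as L

record FiniteField (n : ℕ) : Set₁ where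
  infixl 6 _+_ _-_
  infixl 7 _*_
  field
    Carrier : Set
    _+_ _*_ : Op₂ Carrier
    -_ : Op₁ Carrier
    0# 1# : Carrier
    isCommutativeRing : IsCommutativeRing _≡_ _+_ _*_ -_ 0# 1#
    0≢1 : 0# ≢ 1#
    inverse : ∀ x → x ≢ 0# → ∃ λ y → x * y ≡ 1#
    enum : Fin n ↔ Carrier

  _-_ : Op₂ Carrier
  x - y = x + (- y)

  _^_ : Carrier → ℕ → Carrier
  x ^ zero = 1#
  x ^ suc k = x * (x ^ k)
  infixr 8 _^_

  toC : Fin n → Carrier
  toC = Inverse.to enum

  fromC : Carrier → Fin n
  fromC = Inverse.from enum

  _≟_ : (x y : Carrier) → Dec (x ≡ y)
  x ≟ y = map′ (λ e → lemma x y e) (cong fromC) (fromC x ≟ᶠ fromC y)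
    where
    lemma : ∀ x y → fromC x ≡ fromC y → x ≡ y
    lemma x y e = trans (sym (Inverse.strictlyInverseˡ enum x))
                    (trans (cong toC e) (Inverse.strictlyInverseˡ enum y))

module _ {n : ℕ} (F : FiniteField n) where
  open FiniteField F

  elements : List Carrier
  elements = L.map toC (L.allFin n)

  #solutions : (Carrier → Carrier) → Carrier → ℕ
  #solutions h b = length (filter (λ x → h x ≟ b) elements)

  cΔ : Carrier → (Carrier → Carrier) → Carrier → Carrier → ℕ
  cΔ c f a b = #solutions (λ x → f (x + a) - c * f x) b

  IsPcN : Carrier → (Carrier → Carrier) → Set
  IsPcN c f = ∀ a b → ¬ (a ≡ 0# × c ≡ 1#) → cΔ c f a b ℕ.≤ 1

  evalPoly : List Carrier → Carrier → Carrier
  evalPoly [] x = 0#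
  evalPoly (c ∷ cs) x = c + x * evalPoly cs x

  -- linearised polynomial Σ_i a_i x^(q^i) with coefficient list [a₀, a₁, …]
  evalLin : ℕ → List Carrier → Carrier → Carrier
  evalLin q [] x = 0#
  evalLin q (a ∷ as) x = a * x + evalLin q as (x ^ q)

  InSubfield : ℕ → Carrier → Set
  InSubfield q a = a ^ q ≡ a

  InJ : ℕ → Carrier → Set
  InJ q y = ∃ λ x → y ≡ x ^ q - x

  IsPermutation : (Carrier → Carrier) → Set
  IsPermutation f = Bijective _≡_ _≡_ f

  f3p10 : (q : ℕ) → (as g : List Carrier) → (b : Carrier) → (s : ℕ) → Carrier → Carrier
  f3p10 q as g b s x = b * evalLin q as x + evalPoly g (x ^ q - x) ^ s

module Submission where

-- Write D(x) = x^q − x.  In F_{q²} the map D is F_q-linear with kernel F_q,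
-- and (D v)^q = −D v, so a product of two elements of J = D(F_{q²}) lies in F_q.
-- Since s = p^h + p^k, the value g(D x)^s is such a product, hence f satisfies
--   (i)  D ∘ f is additive  (indeed D(f x) = b·φ(D x)), and
--   (ii) f(z + t) = f(z) + B·t for t ∈ F_q, where B = b·φ(1) ∈ F_q.
-- The PcN criterion shows that any injective f with (i) and (ii) has injective
-- c-derivatives x ↦ f(x + a) − c·f(x) for c ∈ F_q \ {1}, i.e. is PcN.

open import Defs
open import Data.Nat using (ℕ)
open import Data.Nat.Primality using (Prime)
open import Data.List using (List)
open import Data.List.Relation.Unary.All using (All)
open import Data.Product using (∃; ∃₂; _×_)
open import Relation.Nullary using (¬_)
open import Relation.Binary.PropositionalEquality using (_≡_; _≢_)

open import Level using (0ℓ)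
import Data.Nat as ℕ
open import Data.Nat using (suc; zero; z≤n; s≤s)
import Data.Nat.Properties as ℕP
open import Data.Nat.Combinatorics using (_C_; nCn≡1; nC1≡n; nCk+nC[k+1]≡[n+1]C[k+1])
open import Data.Nat.Divisibility using (_∣_; divides; >⇒∤)
open import Data.Nat.Primality using (euclidsLemma; prime⇒nonTrivial)
open import Data.Nat.Tactic.RingSolver using (solve-∀)
open import Data.Fin using (Fin; toℕ; fromℕ; inject₁; punchIn)
import Data.Fin as Fin
open import Data.Fin.Properties using (toℕ<n; toℕ-inject₁; toℕ-fromℕ; punchInᵢ≢i)
open import Data.Fin.Permutation using (Permutation; permutation)
open import Data.List using ([]; _∷_; length; filter)
open import Data.List.Relation.Unary.All using ([]; _∷_)
open import Data.List.Relation.Unary.All.Properties using (all-filter)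
open import Data.List.Relation.Unary.Unique.Propositional using (Unique)
open import Data.List.Relation.Unary.Unique.Propositional.Properties using (filter⁺; map⁺; allFin⁺)
open import Data.List.Relation.Unary.AllPairs using ([]; _∷_)
open import Data.Product using (_,_; proj₁)
open import Data.Sum using (_⊎_; inj₁; inj₂)
open import Data.Empty using (⊥-elim)
open import Function using (_∘_)
open import Relation.Nullary using (yes; no)
open import Relation.Unary using (Decidable)
open import Relation.Binary.PropositionalEquality using (refl; sym; trans; cong; cong₂; subst; module ≡-Reasoning)
open import Function.Bundles using (Inverse)
open import Algebra.Bundles using (CommutativeRing; CommutativeSemiring; CommutativeMonoid)

filter-length≤1 : {A : Set} {P : A → Set} (P? : Decidable P) (xs : List A) → Unique xs →
                  (∀ x y → P x → P y → x ≡ y) → length (filter P? xs) ℕ.≤ 1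
filter-length≤1 {P = P} P? xs xs-unique P-unique =
  at-most-one (filter P? xs) (filter⁺ P? xs-unique) (all-filter P? xs)
  where
  at-most-one : ∀ ys → Unique ys → All P ys → length ys ℕ.≤ 1
  at-most-one [] _ _ = z≤n
  at-most-one (_ ∷ []) _ _ = s≤s z≤n
  at-most-one (x ∷ y ∷ _) ((x≢y ∷ _) ∷ _) (px ∷ py ∷ _) = ⊥-elim (x≢y (P-unique x y px py))

suc-*-C : ∀ n k → suc k ℕ.* (suc n C suc k) ≡ suc n ℕ.* (n C k)
suc-*-C zero zero = refl
suc-*-C zero (suc k) = ℕP.*-zeroʳ (suc (suc k))
suc-*-C (suc n) zero = trans (ℕP.*-identityˡ _) (trans (nC1≡n (suc (suc n))) (sym (ℕP.*-identityʳ _)))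
suc-*-C (suc n) (suc k) = begin
  suc (suc k) ℕ.* (suc (suc n) C suc (suc k))
    ≡⟨ cong (suc (suc k) ℕ.*_) (sym (nCk+nC[k+1]≡[n+1]C[k+1] (suc n) (suc k))) ⟩
  suc (suc k) ℕ.* (P₀ ℕ.+ P₁)
    ≡⟨ split-factor k P₀ P₁ ⟩
  (suc k ℕ.* P₀ ℕ.+ suc (suc k) ℕ.* P₁) ℕ.+ P₀
    ≡⟨ cong₂ (λ u v → (u ℕ.+ v) ℕ.+ P₀) (suc-*-C n k) (suc-*-C n (suc k)) ⟩
  (suc n ℕ.* (n C k) ℕ.+ suc n ℕ.* (n C suc k)) ℕ.+ P₀
    ≡⟨ cong (ℕ._+ P₀) (sym (ℕP.*-distribˡ-+ (suc n) (n C k) (n C suc k))) ⟩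
  suc n ℕ.* ((n C k) ℕ.+ (n C suc k)) ℕ.+ P₀
    ≡⟨ cong (λ u → suc n ℕ.* u ℕ.+ P₀) (nCk+nC[k+1]≡[n+1]C[k+1] n k) ⟩
  suc n ℕ.* P₀ ℕ.+ P₀
    ≡⟨ ℕP.+-comm (suc n ℕ.* P₀) P₀ ⟩
  suc (suc n) ℕ.* P₀
    ∎
  where
  open ≡-Reasoning
  P₀ = suc n C suc k
  P₁ = suc n C suc (suc k)
  split-factor : ∀ k a b → suc (suc k) ℕ.* (a ℕ.+ b) ≡ (suc k ℕ.* a ℕ.+ suc (suc k) ℕ.* b) ℕ.+ a
  split-factor = solve-∀

-- A prime p divides C(p, k) for 0 < k < p: it divides k·C(p,k) = p·C(p-1,k-1)
-- but not k.
prime∣C : ∀ {p} k → Prime (suc p) → k ℕ.< p → suc p ∣ (suc p C suc k)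
prime∣C {p} k p-prime k<p with euclidsLemma (suc k) (suc p C suc k) p-prime
                                  (divides (p C k) (trans (suc-*-C p k) (ℕP.*-comm (suc p) (p C k))))
... | inj₂ p∣C = p∣C
... | inj₁ p∣k = ⊥-elim (>⇒∤ (s≤s k<p) p∣k)

-- The Frobenius identity (x + y)^p = x^p + y^p in a commutative semiring in
-- which p · 1 = 0 for a prime p: all inner binomial coefficients vanish.
module Frobenius {a ℓ} (S : CommutativeSemiring a ℓ) where
  open CommutativeSemiring S hiding (refl; sym) renaming (trans to ≈-trans)
  open import Algebra.Properties.Semiring.Exp semiring using (_^_)
  open import Algebra.Properties.Semiring.Mult semiring
    using (×-assocˡ; ×-congʳ; ×-assoc-*) renaming (_×_ to _·_)
  open import Algebra.Properties.CommutativeSemiring.Binomial S using (theorem; binomialTerm)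
  open import Algebra.Properties.CommutativeMonoid.Sum +-commutativeMonoid
    using (sum; sum-init-last; sum-cong-≋; sum-replicate-zero)
  open import Relation.Binary.Reasoning.Setoid setoid

  multiple-of-char : ∀ {p} → p · 1# ≈ 0# → ∀ n z → p ∣ n → n · z ≈ 0#
  multiple-of-char {p} p·1≈0 .(c ℕ.* p) z (divides c refl) = begin
    (c ℕ.* p) · z     ≈⟨ ×-assocˡ z c p ⟨
    c · (p · z)       ≈⟨ ×-congʳ c p·z≈0 ⟩
    c · 0#            ≈⟨ ×-congʳ c (zeroˡ 0#) ⟨
    c · (0# * 0#)     ≈⟨ ×-assoc-* c 0# 0# ⟨
    (c · 0#) * 0#     ≈⟨ zeroʳ (c · 0#) ⟩
    0#                ∎
    where
    p·z≈0 : p · z ≈ 0#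
    p·z≈0 = begin
      p · z          ≈⟨ ×-congʳ p (*-identityˡ z) ⟨
      p · (1# * z)   ≈⟨ ×-assoc-* p 1# z ⟨
      (p · 1#) * z   ≈⟨ *-congʳ p·1≈0 ⟩
      0# * z         ≈⟨ zeroˡ z ⟩
      0#             ∎

  frobenius : ∀ {p} → Prime p → p · 1# ≈ 0# → ∀ x y → (x + y) ^ p ≈ x ^ p + y ^ p
  frobenius {zero} p-prime _ = ⊥-elim (ℕ.NonTrivial.nonTrivial (prime⇒nonTrivial p-prime))
  frobenius {suc p} p-prime p·1≈0 x y = begin
    (x + y) ^ suc p                                              ≈⟨ theorem (suc p) x y ⟩
    t Fin.zero + sum (t ∘ Fin.suc)                               ≈⟨ +-congˡ (sum-init-last (t ∘ Fin.suc)) ⟩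
    t Fin.zero + (sum (t ∘ Fin.suc ∘ inject₁) + t (Fin.suc (fromℕ p)))
                                                                 ≈⟨ +-congˡ (+-cong inner-terms last-term) ⟩
    t Fin.zero + (0# + x ^ suc p)                                ≈⟨ +-cong first-term (+-identityˡ _) ⟩
    y ^ suc p + x ^ suc p                                        ≈⟨ +-comm _ _ ⟩
    x ^ suc p + y ^ suc p                                        ∎
    where
    t = binomialTerm x y (suc p)

    first-term : t Fin.zero ≈ y ^ suc p
    first-term = ≈-trans (+-identityʳ _) (*-identityˡ _)

    inner-terms : sum (t ∘ Fin.suc ∘ inject₁) ≈ 0#
    inner-terms = ≈-trans (sum-cong-≋ inner-term-vanishes) (sum-replicate-zero p)
      where
      inner-term-vanishes : ∀ i → t (Fin.suc (inject₁ i)) ≈ 0#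
      inner-term-vanishes i = multiple-of-char p·1≈0 _ _
        (prime∣C (toℕ (inject₁ i)) p-prime (subst (ℕ._< p) (sym (toℕ-inject₁ i)) (toℕ<n i)))

    last-term : t (Fin.suc (fromℕ p)) ≈ x ^ suc p
    last-term = begin
      t (Fin.suc (fromℕ p))
        ≡⟨ cong (λ k → (suc p C k) · (x ^ k * y ^ (suc p ℕ.∸ k))) (cong suc (toℕ-fromℕ p)) ⟩
      (suc p C suc p) · (x ^ suc p * y ^ (suc p ℕ.∸ suc p))
        ≡⟨ cong₂ (λ c k → c · (x ^ suc p * y ^ k)) (nCn≡1 (suc p)) (ℕP.n∸n≡0 (suc p)) ⟩
      1 · (x ^ suc p * 1#)                                    ≈⟨ +-identityʳ _ ⟩
      x ^ suc p * 1#                                          ≈⟨ *-identityʳ _ ⟩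
      x ^ suc p                                               ∎

module FieldFacts {n : ℕ} (F : FiniteField n) where
  open FiniteField F public
  open ≡-Reasoning

  commutativeRing : CommutativeRing 0ℓ 0ℓ
  commutativeRing = record { isCommutativeRing = isCommutativeRing }

  open CommutativeRing commutativeRing public
    using ( +-comm; +-identityˡ; +-identityʳ; -‿inverseʳ
          ; *-assoc; *-comm; *-identityˡ; *-identityʳ; distribˡ; distribʳ; zeroˡ; zeroʳ)
  open CommutativeRing commutativeRing
    using (ring; +-group; +-abelianGroup; semiring; commutativeSemiring; +-commutativeSemigroup; *-commutativeSemigroup)
  open import Algebra.Properties.Ring ring public
    using (x[y-z]≈xy-xz; [y-z]x≈yx-zx; x+x≈x⇒x≈0; -‿distribˡ-*; -‿distribʳ-*)
  open import Algebra.Properties.Group +-group public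
    using (∙-cancelˡ; ∙-cancelʳ; inverseʳ-unique; x∙y⁻¹≈ε⇒x≈y; ⁻¹-involutive)
    renaming (//-rightDividesˡ to [y-x]+x≡y; //-rightDividesʳ to [y+x]-x≡y)
  open import Algebra.Properties.Semiring.Mult semiring public using (×1-homo-*) renaming (_×_ to _·_)
  open import Algebra.Properties.AbelianGroup +-abelianGroup public using (⁻¹-anti-homo‿-; ⁻¹-∙-comm)
  open import Algebra.Properties.CommutativeSemigroup +-commutativeSemigroup public
    using () renaming (interchange to +-interchange; xy∙z≈xz∙y to [x+y]+z≡[x+z]+y)
  open import Algebra.Properties.CommutativeSemigroup *-commutativeSemigroup public
    using () renaming (interchange to *-interchange; xy∙z≈zy∙x to [xy]z≡[zy]x)

  +-sub-interchange : ∀ a b c d → (a + b) - (c + d) ≡ (a - c) + (b - d)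
  +-sub-interchange a b c d = begin
    (a + b) + - (c + d)       ≡⟨ cong ((a + b) +_) (sym (⁻¹-∙-comm c d)) ⟩
    (a + b) + (- c + - d)     ≡⟨ +-interchange a b (- c) (- d) ⟩
    (a + - c) + (b + - d)     ∎

  *-cancelˡ-≢0 : ∀ x {y z} → x ≢ 0# → x * y ≡ x * z → y ≡ z
  *-cancelˡ-≢0 x {y} {z} x≢0 xy≡xz with inverse x x≢0
  ... | w , xw≡1 = begin
    y              ≡⟨ sym (*-identityˡ y) ⟩
    1# * y         ≡⟨ cong (_* y) (trans (sym xw≡1) (*-comm x w)) ⟩
    (w * x) * y    ≡⟨ *-assoc w x y ⟩
    w * (x * y)    ≡⟨ cong (w *_) xy≡xz ⟩
    w * (x * z)    ≡⟨ sym (*-assoc w x z) ⟩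
    (w * x) * z    ≡⟨ cong (_* z) (trans (*-comm w x) xw≡1) ⟩
    1# * z         ≡⟨ *-identityˡ z ⟩
    z              ∎

  zero-product : ∀ x y → x * y ≡ 0# → x ≡ 0# ⊎ y ≡ 0#
  zero-product x y xy≡0 with x ≟ 0#
  ... | yes x≡0 = inj₁ x≡0
  ... | no x≢0 = inj₂ (*-cancelˡ-≢0 x x≢0 (trans xy≡0 (sym (zeroʳ x))))

  *-≢0 : ∀ {x y} → x ≢ 0# → y ≢ 0# → x * y ≢ 0#
  *-≢0 {x} {y} x≢0 y≢0 xy≡0 with zero-product x y xy≡0
  ... | inj₁ x≡0 = x≢0 x≡0
  ... | inj₂ y≡0 = y≢0 y≡0

  *-≡0⇒≡0 : ∀ {x y} → x ≢ 0# → x * y ≡ 0# → y ≡ 0#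
  *-≡0⇒≡0 {x} x≢0 xy≡0 = *-cancelˡ-≢0 x x≢0 (trans xy≡0 (sym (zeroʳ x)))

  -*- : ∀ x y → (- x) * (- y) ≡ x * y
  -*- x y = begin
    (- x) * (- y)     ≡⟨ sym (-‿distribˡ-* x (- y)) ⟩
    - (x * - y)       ≡⟨ cong -_ (sym (-‿distribʳ-* x y)) ⟩
    - (- (x * y))     ≡⟨ ⁻¹-involutive (x * y) ⟩
    x * y             ∎

  preserves-0 : (h : Carrier → Carrier) → (∀ x y → h (x + y) ≡ h x + h y) → h 0# ≡ 0#
  preserves-0 h h-additive = x+x≈x⇒x≈0 (h 0#) (trans (sym (h-additive 0# 0#)) (cong h (+-identityʳ 0#)))

  preserves-sub : (h : Carrier → Carrier) → (∀ x y → h (x + y) ≡ h x + h y) →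
                  ∀ x y → h (x - y) ≡ h x - h y
  preserves-sub h h-additive x y = trans (h-additive x (- y)) (cong (h x +_) h-neg)
    where
    h-neg : h (- y) ≡ - h y
    h-neg = inverseʳ-unique (h y) (h (- y))
      (trans (sym (h-additive y (- y))) (trans (cong h (-‿inverseʳ y)) (preserves-0 h h-additive)))

  ^-+ : ∀ x a b → x ^ (a ℕ.+ b) ≡ x ^ a * x ^ b
  ^-+ x zero b = sym (*-identityˡ _)
  ^-+ x (suc a) b = trans (cong (x *_) (^-+ x a b)) (sym (*-assoc x _ _))

  *-^ : ∀ x y a → (x * y) ^ a ≡ x ^ a * y ^ a
  *-^ x y zero = sym (*-identityˡ 1#)
  *-^ x y (suc a) = trans (cong ((x * y) *_) (*-^ x y a)) (*-interchange x y _ _)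

  1^ : ∀ a → 1# ^ a ≡ 1#
  1^ zero = refl
  1^ (suc a) = trans (*-identityˡ _) (1^ a)

  ^-* : ∀ x a b → x ^ (a ℕ.* b) ≡ (x ^ a) ^ b
  ^-* x zero b = sym (1^ b)
  ^-* x (suc a) b = begin
    x ^ (b ℕ.+ a ℕ.* b)      ≡⟨ ^-+ x b (a ℕ.* b) ⟩
    x ^ b * x ^ (a ℕ.* b)    ≡⟨ cong (x ^ b *_) (^-* x a b) ⟩
    x ^ b * (x ^ a) ^ b      ≡⟨ sym (*-^ x (x ^ a) b) ⟩
    (x * x ^ a) ^ b          ∎

  ^-comm : ∀ x a b → (x ^ a) ^ b ≡ (x ^ b) ^ a
  ^-comm x a b = trans (sym (^-* x a b)) (trans (cong (x ^_) (ℕP.*-comm a b)) (^-* x b a))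

  ^≡0⇒≡0 : ∀ x k → x ^ k ≡ 0# → x ≡ 0#
  ^≡0⇒≡0 x zero 1≡0 = ⊥-elim (0≢1 (sym 1≡0))
  ^≡0⇒≡0 x (suc k) xᵏ⁺¹≡0 with zero-product x (x ^ k) xᵏ⁺¹≡0
  ... | inj₁ x≡0 = x≡0
  ... | inj₂ xᵏ≡0 = ^≡0⇒≡0 x k xᵏ≡0

  Additive : ℕ → Set
  Additive k = ∀ x y → (x + y) ^ k ≡ x ^ k + y ^ k

  additive-sub : ∀ k → Additive k → ∀ x y → (x - y) ^ k ≡ x ^ k - y ^ k
  additive-sub k = preserves-sub (_^ k)

  prime-power-additive : ∀ {p} → Prime p → p · 1# ≡ 0# → ∀ e → Additive (p ℕ.^ e)
  prime-power-additive {p} p-prime p·1≡0 zero x y =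
    trans (*-identityʳ _) (sym (cong₂ _+_ (*-identityʳ x) (*-identityʳ y)))
  prime-power-additive {p} p-prime p·1≡0 (suc e) x y = begin
    (x + y) ^ (p ℕ.* p ℕ.^ e)                   ≡⟨ ^-* (x + y) p (p ℕ.^ e) ⟩
    ((x + y) ^ p) ^ (p ℕ.^ e)                   ≡⟨ cong (_^ (p ℕ.^ e)) frobenius ⟩
    (x ^ p + y ^ p) ^ (p ℕ.^ e)                 ≡⟨ prime-power-additive p-prime p·1≡0 e (x ^ p) (y ^ p) ⟩
    (x ^ p) ^ (p ℕ.^ e) + (y ^ p) ^ (p ℕ.^ e)   ≡⟨ sym (cong₂ _+_ (^-* x p (p ℕ.^ e)) (^-* y p (p ℕ.^ e))) ⟩
    x ^ (p ℕ.* p ℕ.^ e) + y ^ (p ℕ.* p ℕ.^ e)   ∎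
    where
    import Algebra.Properties.Semiring.Exp semiring as Exp
    ^≡Exp^ : ∀ x k → x ^ k ≡ x Exp.^ k
    ^≡Exp^ x zero = refl
    ^≡Exp^ x (suc k) = cong (x *_) (^≡Exp^ x k)
    frobenius : (x + y) ^ p ≡ x ^ p + y ^ p
    frobenius = begin
      (x + y) ^ p                ≡⟨ ^≡Exp^ (x + y) p ⟩
      (x + y) Exp.^ p            ≡⟨ Frobenius.frobenius commutativeSemiring p-prime p·1≡0 x y ⟩
      x Exp.^ p + y Exp.^ p      ≡⟨ sym (cong₂ _+_ (^≡Exp^ x p) (^≡Exp^ y p)) ⟩
      x ^ p + y ^ p              ∎

module FiniteFieldFacts {n : ℕ} (F : FiniteField n) where
  open FieldFacts F
  open ≡-Reasoning

  toC-fromC : ∀ x → toC (fromC x) ≡ x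
  toC-fromC = Inverse.strictlyInverseˡ enum

  fromC-toC : ∀ i → fromC (toC i) ≡ i
  fromC-toC = Inverse.strictlyInverseʳ enum

  toC-injective : ∀ {i j} → toC i ≡ toC j → i ≡ j
  toC-injective {i} {j} toCi≡toCj = trans (sym (fromC-toC i)) (trans (cong fromC toCi≡toCj) (fromC-toC j))

  #solutions≤1 : (h : Carrier → Carrier) → (∀ x y → h x ≡ h y → x ≡ y) →
                 ∀ b → #solutions F h b ℕ.≤ 1
  #solutions≤1 h h-injective b =
    filter-length≤1 (λ x → h x ≟ b) (elements F) elements-unique
      (λ x y hx≡b hy≡b → h-injective x y (trans hx≡b (sym hy≡b)))
    where
    elements-unique : Unique (elements F)
    elements-unique = map⁺ toC-injective (allFin⁺ n)

  module Reindex {c ℓ} (M : CommutativeMonoid c ℓ) where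
    open CommutativeMonoid M using (_≈_) renaming (Carrier to A; trans to ≈-trans; reflexive to ≈-reflexive)
    open import Algebra.Properties.CommutativeMonoid.Sum M using (sum; sum-permute; sum-cong-≗)

    sum-bijection : (w : Carrier → A) (σ σ⁻¹ : Carrier → Carrier) →
                    (∀ x → σ (σ⁻¹ x) ≡ x) → (∀ x → σ⁻¹ (σ x) ≡ x) →
                    sum (w ∘ toC) ≈ sum (w ∘ σ ∘ toC)
    sum-bijection w σ σ⁻¹ σσ⁻¹ σ⁻¹σ =
      ≈-trans (sum-permute (w ∘ toC) π) (≈-reflexive (sum-cong-≗ (λ i → cong w (toC-fromC (σ (toC i))))))
      where
      on-indices : (Carrier → Carrier) → Fin n → Fin n
      on-indices τ = fromC ∘ τ ∘ toC
      inverse-on-indices : ∀ τ τ′ → (∀ x → τ (τ′ x) ≡ x) → ∀ i → on-indices τ (on-indices τ′ i) ≡ i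
      inverse-on-indices τ τ′ ττ′ i =
        trans (cong (fromC ∘ τ) (toC-fromC (τ′ (toC i)))) (trans (cong fromC (ττ′ (toC i))) (fromC-toC i))
      π : Permutation n n
      π = permutation (on-indices σ) (on-indices σ⁻¹) (inverse-on-indices σ σ⁻¹ σσ⁻¹) (inverse-on-indices σ⁻¹ σ σ⁻¹σ)

  open CommutativeRing commutativeRing using (+-commutativeMonoid; *-commutativeMonoid)
  open Reindex +-commutativeMonoid using () renaming (sum-bijection to ∑-bijection)
  open Reindex *-commutativeMonoid using () renaming (sum-bijection to ∏-bijection)
  open import Algebra.Properties.CommutativeMonoid.Sum +-commutativeMonoid using (∑-distrib-+; sum-replicate)
    renaming (sum to ∑)
  open import Algebra.Properties.CommutativeMonoid.Sum *-commutativeMonoid using (sum-remove; sum-cong-≗)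
    renaming (sum to ∏; ∑-distrib-+ to ∏-distrib-*)

  -- n · x = 0 for every x: translating by x permutes the field, so
  -- ∑ y = ∑ (y + x) = ∑ y + n · x.
  n·x≡0 : ∀ x → n · x ≡ 0#
  n·x≡0 x = sym (∙-cancelˡ S 0# (n · x) (begin
    S + 0#                    ≡⟨ +-identityʳ S ⟩
    S                         ≡⟨ ∑-bijection (λ y → y) (_+ x) (_- x) (λ y → [y-x]+x≡y x y) (λ y → [y+x]-x≡y x y) ⟩
    ∑ (λ i → toC i + x)       ≡⟨ ∑-distrib-+ toC (λ _ → x) ⟩
    S + ∑ {n} (λ _ → x)       ≡⟨ cong (S +_) (sum-replicate n) ⟩
    S + n · x                 ∎))
    where
    S = ∑ toC

  -- In a field of order p^k we have p · 1 = 0, since (p · 1)^k = p^k · 1 = 0.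
  characteristic : ∀ p k → n ≡ p ℕ.^ k → p · 1# ≡ 0#
  characteristic p k n≡pᵏ = ^≡0⇒≡0 (p · 1#) k (begin
    (p · 1#) ^ k       ≡⟨ sym (pᵏ·1≡[p·1]ᵏ k) ⟩
    (p ℕ.^ k) · 1#     ≡⟨ cong (_· 1#) (sym n≡pᵏ) ⟩
    n · 1#             ≡⟨ n·x≡0 1# ⟩
    0#                 ∎)
    where
    pᵏ·1≡[p·1]ᵏ : ∀ k → (p ℕ.^ k) · 1# ≡ (p · 1#) ^ k
    pᵏ·1≡[p·1]ᵏ zero = +-identityʳ 1#
    pᵏ·1≡[p·1]ᵏ (suc k) = trans (×1-homo-* p (p ℕ.^ k)) (cong ((p · 1#) *_) (pᵏ·1≡[p·1]ᵏ k))

  ∏-const : ∀ k x → ∏ {k} (λ _ → x) ≡ x ^ k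
  ∏-const zero x = refl
  ∏-const (suc k) x = cong (x *_) (∏-const k x)

  ∏-≢0 : ∀ {k} (f : Fin k → Carrier) → (∀ i → f i ≢ 0#) → ∏ f ≢ 0#
  ∏-≢0 {zero} f _ 1≡0 = 0≢1 (sym 1≡0)
  ∏-≢0 {suc k} f f≢0 = *-≢0 (f≢0 Fin.zero) (∏-≢0 (f ∘ Fin.suc) (f≢0 ∘ Fin.suc))

  ∏-swap-at : ∀ {k} (f g : Fin k → Carrier) (j : Fin k) → (∀ i → i ≢ j → f i ≡ g i) →
              ∏ f * g j ≡ ∏ g * f j
  ∏-swap-at {suc k} f g j agree = begin
    ∏ f * g j                    ≡⟨ cong (_* g j) (sum-remove {i = j} f) ⟩
    (f j * ∏ (f ∘ punchIn j)) * g j  ≡⟨ cong (λ r → (f j * r) * g j) (sum-cong-≗ (λ i → agree (punchIn j i) (punchInᵢ≢i j i))) ⟩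
    (f j * R) * g j              ≡⟨ [xy]z≡[zy]x (f j) R (g j) ⟩
    (g j * R) * f j              ≡⟨ cong (_* f j) (sym (sum-remove {i = j} g)) ⟩
    ∏ g * f j                    ∎
    where
    R = ∏ (g ∘ punchIn j)

  -- y with 0 replaced by 1, so that ∏ (unit-part y) over the field is nonzero.
  unit-part : Carrier → Carrier
  unit-part y with y ≟ 0#
  ... | yes _ = 1#
  ... | no _ = y

  unit-part-0 : unit-part 0# ≡ 1#
  unit-part-0 with 0# ≟ 0#
  ... | yes _ = refl
  ... | no 0≢0 = ⊥-elim (0≢0 refl)

  unit-part-≢0 : ∀ {y} → y ≢ 0# → unit-part y ≡ y
  unit-part-≢0 {y} y≢0 with y ≟ 0#
  ... | yes y≡0 = ⊥-elim (y≢0 y≡0)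
  ... | no _ = refl

  unit-part≢0 : ∀ y → unit-part y ≢ 0#
  unit-part≢0 y with y ≟ 0#
  ... | yes _ = λ 1≡0 → 0≢1 (sym 1≡0)
  ... | no y≢0 = y≢0

  -- For x ≠ 0, multiplication by x permutes the
  -- field, so H = ∏ unit-part(y) = ∏ unit-part(x·y); comparing the latter with
  -- ∏ x·unit-part(y) = x^n·H (the factors differ only at y = 0) gives H·x = H·x^n.
  fermat : ∀ x → x ^ n ≡ x
  fermat x with x ≟ 0#
  ... | yes refl = 0^-positive (fromC 0#)
    where
    0^-positive : ∀ {k} → Fin k → 0# ^ k ≡ 0#
    0^-positive {suc k} _ = zeroˡ _
  ... | no x≢0 with inverse x x≢0
  ...   | w , xw≡1 = *-cancelˡ-≢0 H (∏-≢0 (unit-part ∘ toC) (unit-part≢0 ∘ toC)) (begin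
    H * x ^ n                  ≡⟨ *-comm H (x ^ n) ⟩
    x ^ n * H                  ≡⟨ sym (*-identityʳ _) ⟩
    (x ^ n * H) * 1#           ≡⟨ cong₂ _*_ (sym ∏g≡xⁿH) (sym fj≡1) ⟩
    ∏ g * f j                  ≡⟨ sym (∏-swap-at f g j f≡g-off-j) ⟩
    ∏ f * g j                  ≡⟨ cong₂ _*_ (sym H≡∏f) gj≡x ⟩
    H * x                      ∎)
    where
    H = ∏ (unit-part ∘ toC)
    f g : Fin n → Carrier
    f i = unit-part (x * toC i)
    g i = x * unit-part (toC i)
    j = fromC 0#

    H≡∏f : H ≡ ∏ f
    H≡∏f = ∏-bijection unit-part (x *_) (w *_)
      (λ y → trans (sym (*-assoc x w y)) (trans (cong (_* y) xw≡1) (*-identityˡ y)))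
      (λ y → trans (sym (*-assoc w x y)) (trans (cong (_* y) (trans (*-comm w x) xw≡1)) (*-identityˡ y)))

    ∏g≡xⁿH : ∏ g ≡ x ^ n * H
    ∏g≡xⁿH = trans (∏-distrib-* (λ _ → x) (unit-part ∘ toC)) (cong (_* H) (∏-const n x))

    toC-j : toC j ≡ 0#
    toC-j = toC-fromC 0#

    fj≡1 : f j ≡ 1#
    fj≡1 = trans (cong (λ y → unit-part (x * y)) toC-j) (trans (cong unit-part (zeroʳ x)) unit-part-0)

    gj≡x : g j ≡ x
    gj≡x = trans (cong (λ y → x * unit-part y) toC-j) (trans (cong (x *_) unit-part-0) (*-identityʳ x))

    f≡g-off-j : ∀ i → i ≢ j → f i ≡ g i
    f≡g-off-j i i≢j = trans (unit-part-≢0 (*-≢0 x≢0 toCi≢0)) (cong (x *_) (sym (unit-part-≢0 toCi≢0)))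
      where
      toCi≢0 : toC i ≢ 0#
      toCi≢0 toCi≡0 = i≢j (toC-injective (trans toCi≡0 (sym toC-j)))

  ^q-involutive : ∀ q → n ≡ q ℕ.* q → ∀ x → (x ^ q) ^ q ≡ x
  ^q-involutive q n≡q² x = trans (sym (^-* x q q)) (trans (cong (x ^_) (sym n≡q²)) (fermat x))

-- The map D(x) = x^q − x on a field in which x ↦ x^q is an additive
-- involution, as in F_{q²}.  Its kernel is the fixed field F_q = {t : t^q = t}.
module QDifference {n : ℕ} (F : FiniteField n) (q : ℕ) (q-additive : FieldFacts.Additive F q)
             (q-involutive : ∀ x → FiniteField._^_ F (FiniteField._^_ F x q) q ≡ x) where
  open FieldFacts F
  open FiniteFieldFacts F using (#solutions≤1)
  open ≡-Reasoning

  InFq : Carrier → Set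
  InFq = InSubfield F q

  InFq-1 : InFq 1#
  InFq-1 = 1^ q

  InFq-* : ∀ {s t} → InFq s → InFq t → InFq (s * t)
  InFq-* {s} {t} s∈Fq t∈Fq = trans (*-^ s t q) (cong₂ _*_ s∈Fq t∈Fq)

  InFq-inverse : ∀ {t w} → InFq t → t ≢ 0# → t * w ≡ 1# → InFq w
  InFq-inverse {t} {w} t∈Fq t≢0 tw≡1 = *-cancelˡ-≢0 t t≢0 (begin
    t * w ^ q         ≡⟨ cong (_* w ^ q) (sym t∈Fq) ⟩
    t ^ q * w ^ q     ≡⟨ sym (*-^ t w q) ⟩
    (t * w) ^ q       ≡⟨ cong (_^ q) tw≡1 ⟩
    1# ^ q            ≡⟨ 1^ q ⟩
    1#                ≡⟨ sym tw≡1 ⟩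
    t * w             ∎)

  D : Carrier → Carrier
  D x = x ^ q - x

  D-+ : ∀ x y → D (x + y) ≡ D x + D y
  D-+ x y = trans (cong (_- (x + y)) (q-additive x y)) (+-sub-interchange _ _ _ _)

  D-- : ∀ x y → D (x - y) ≡ D x - D y
  D-- = preserves-sub D D-+

  D-scalar : ∀ {t} v → InFq t → D (t * v) ≡ t * D v
  D-scalar {t} v t∈Fq =
    trans (cong (_- (t * v)) (trans (*-^ t v q) (cong (_* v ^ q) t∈Fq))) (sym (x[y-z]≈xy-xz t (v ^ q) v))

  InFq⇒D≡0 : ∀ {t} → InFq t → D t ≡ 0#
  InFq⇒D≡0 {t} t∈Fq = trans (cong (_- t) t∈Fq) (-‿inverseʳ t)

  D≡⇒difference-InFq : ∀ {x y} → D x ≡ D y → InFq (x - y)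
  D≡⇒difference-InFq {x} {y} Dx≡Dy = x∙y⁻¹≈ε⇒x≈y ((x - y) ^ q) (x - y)
    (trans (D-- x y) (trans (cong (_- D y) Dx≡Dy) (-‿inverseʳ (D y))))

  D-shift : ∀ z {t} → InFq t → D (z + t) ≡ D z
  D-shift z t∈Fq = trans (D-+ z _) (trans (cong (D z +_) (InFq⇒D≡0 t∈Fq)) (+-identityʳ (D z)))

  -- On J = D(F) the q-th power acts as negation ...
  D-conjugate : ∀ v → D v ^ q ≡ - D v
  D-conjugate v = begin
    (v ^ q - v) ^ q         ≡⟨ additive-sub q q-additive (v ^ q) v ⟩
    (v ^ q) ^ q - v ^ q     ≡⟨ cong (_- v ^ q) (q-involutive v) ⟩
    v - v ^ q               ≡⟨ sym (⁻¹-anti-homo‿- (v ^ q) v) ⟩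
    - (v ^ q - v)           ∎

  -- ... so the product of two elements of J lies in F_q.
  J-product-InFq : ∀ v w → InFq (D v * D w)
  J-product-InFq v w = begin
    (D v * D w) ^ q         ≡⟨ *-^ (D v) (D w) q ⟩
    D v ^ q * D w ^ q       ≡⟨ cong₂ _*_ (D-conjugate v) (D-conjugate w) ⟩
    (- D v) * (- D w)       ≡⟨ -*- (D v) (D w) ⟩
    D v * D w               ∎

  D-^ : ∀ k → Additive k → ∀ u → D u ^ k ≡ D (u ^ k)
  D-^ k k-additive u = trans (additive-sub k k-additive (u ^ q) u) (cong (_- u ^ k) (^-comm u q k))

  lin-+ : ∀ as x y → evalLin F q as (x + y) ≡ evalLin F q as x + evalLin F q as y
  lin-+ [] x y = sym (+-identityˡ 0#)
  lin-+ (a ∷ as) x y = begin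
    a * (x + y) + L ((x + y) ^ q)
      ≡⟨ cong₂ _+_ (distribˡ a x y) (trans (cong L (q-additive x y)) (lin-+ as (x ^ q) (y ^ q))) ⟩
    (a * x + a * y) + (L (x ^ q) + L (y ^ q))  ≡⟨ +-interchange _ _ _ _ ⟩
    (a * x + L (x ^ q)) + (a * y + L (y ^ q))  ∎
    where
    L = evalLin F q as

  lin-^q : ∀ {as} → All InFq as → ∀ x → evalLin F q as x ^ q ≡ evalLin F q as (x ^ q)
  lin-^q [] x = preserves-0 (_^ q) q-additive
  lin-^q {a ∷ as} (a∈Fq ∷ as∈Fq) x = begin
    (a * x + L (x ^ q)) ^ q             ≡⟨ q-additive _ _ ⟩
    (a * x) ^ q + L (x ^ q) ^ q         ≡⟨ cong₂ _+_ (trans (*-^ a x q) (cong (_* x ^ q) a∈Fq)) (lin-^q as∈Fq (x ^ q)) ⟩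
    a * x ^ q + L ((x ^ q) ^ q)         ∎
    where
    L = evalLin F q as

  lin-InFq : ∀ as {t} → InFq t → evalLin F q as t ≡ evalLin F q as 1# * t
  lin-InFq [] {t} _ = sym (zeroˡ t)
  lin-InFq (a ∷ as) {t} t∈Fq = begin
    a * t + L (t ^ q)                  ≡⟨ cong (λ u → a * t + L u) t∈Fq ⟩
    a * t + L t                        ≡⟨ cong (a * t +_) (lin-InFq as t∈Fq) ⟩
    a * t + L 1# * t                   ≡⟨ sym (distribʳ t a (L 1#)) ⟩
    (a + L 1#) * t                     ≡⟨ cong₂ (λ u v → (u + L v) * t) (sym (*-identityʳ a)) (sym (1^ q)) ⟩
    (a * 1# + L (1# ^ q)) * t          ∎
    where
    L = evalLin F q as

  D-lin : ∀ {as} → All InFq as → ∀ x → D (evalLin F q as x) ≡ evalLin F q as (D x)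
  D-lin {as} as∈Fq x = trans (cong (_- L x) (lin-^q as∈Fq x)) (sym (preserves-sub L (lin-+ as) (x ^ q) x))
    where
    L = evalLin F q as

  module PcNCriterion (f : Carrier → Carrier) (f-injective : ∀ {x y} → f x ≡ f y → x ≡ y)
                      (D∘f-additive : ∀ x y → D (f (x + y)) ≡ D (f x) + D (f y))
                      (B : Carrier) (B∈Fq : InFq B)
                      (f-shift : ∀ z {t} → InFq t → f (z + t) ≡ f z + B * t) where

    B≢0 : B ≢ 0#
    B≢0 B≡0 = 0≢1 (sym (trans (sym (+-identityˡ 1#)) (f-injective (begin
      f (0# + 1#)        ≡⟨ f-shift 0# InFq-1 ⟩
      f 0# + B * 1#      ≡⟨ cong (λ u → f 0# + u * 1#) B≡0 ⟩
      f 0# + 0# * 1#     ≡⟨ cong (f 0# +_) (zeroˡ 1#) ⟩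
      f 0# + 0#          ≡⟨ +-identityʳ (f 0#) ⟩
      f 0#               ∎))))

    -- D ∘ f determines the F_q-coset: if D(f x) = D(f y) then f y − f x ∈ F_q,
    -- and shifting x by B⁻¹(f y − f x) ∈ F_q reaches y.
    D∘f-reflects : ∀ {x y} → D (f x) ≡ D (f y) → D x ≡ D y
    D∘f-reflects {x} {y} Dfx≡Dfy with inverse B B≢0
    ... | w , Bw≡1 = trans (sym (D-shift x t′∈Fq)) (cong D x+t′≡y)
      where
      t = f y - f x
      t′ = w * t
      t′∈Fq : InFq t′
      t′∈Fq = InFq-* (InFq-inverse B∈Fq B≢0 Bw≡1) (D≡⇒difference-InFq (sym Dfx≡Dfy))
      x+t′≡y : x + t′ ≡ y
      x+t′≡y = f-injective (begin
        f (x + t′)          ≡⟨ f-shift x t′∈Fq ⟩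
        f x + B * (w * t)   ≡⟨ cong (f x +_) (trans (sym (*-assoc B w t)) (trans (cong (_* t) Bw≡1) (*-identityˡ t))) ⟩
        f x + (f y - f x)   ≡⟨ +-comm (f x) t ⟩
        (f y - f x) + f x   ≡⟨ [y-x]+x≡y (f x) (f y) ⟩
        f y                 ∎)

    module Derivative (c : Carrier) (c∈Fq : InFq c) (c≢1 : c ≢ 1#) (a : Carrier) where
      Δ : Carrier → Carrier
      Δ x = f (x + a) - c * f x

      1-c≢0 : 1# - c ≢ 0#
      1-c≢0 1-c≡0 = c≢1 (sym (x∙y⁻¹≈ε⇒x≈y 1# c 1-c≡0))

      [1-c]* : ∀ u → (1# - c) * u ≡ u - c * u
      [1-c]* u = trans ([y-z]x≈yx-zx u 1# c) (cong (_- c * u) (*-identityˡ u))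

      D∘Δ : ∀ x → D (Δ x) ≡ (1# - c) * D (f x) + D (f a)
      D∘Δ x = begin
        D (f (x + a) - c * f x)                 ≡⟨ D-- _ _ ⟩
        D (f (x + a)) - D (c * f x)             ≡⟨ cong₂ _-_ (D∘f-additive x a) (D-scalar (f x) c∈Fq) ⟩
        (D (f x) + D (f a)) - c * D (f x)       ≡⟨ [x+y]+z≡[x+z]+y _ _ _ ⟩
        (D (f x) - c * D (f x)) + D (f a)       ≡⟨ cong (_+ D (f a)) (sym ([1-c]* (D (f x)))) ⟩
        (1# - c) * D (f x) + D (f a)            ∎

      Δ-shift : ∀ y {t} → InFq t → Δ (y + t) ≡ Δ y + (1# - c) * (B * t)
      Δ-shift y {t} t∈Fq = begin
        f ((y + t) + a) - c * f (y + t)                   ≡⟨ cong₂ (λ u v → u - c * v) shift-y+a (f-shift y t∈Fq) ⟩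
        (f (y + a) + B * t) - c * (f y + B * t)           ≡⟨ cong (λ u → (f (y + a) + B * t) - u) (distribˡ c (f y) (B * t)) ⟩
        (f (y + a) + B * t) - (c * f y + c * (B * t))     ≡⟨ +-sub-interchange _ _ _ _ ⟩
        Δ y + (B * t - c * (B * t))                       ≡⟨ cong (Δ y +_) (sym ([1-c]* (B * t))) ⟩
        Δ y + (1# - c) * (B * t)                          ∎
        where
        shift-y+a : f ((y + t) + a) ≡ f (y + a) + B * t
        shift-y+a = trans (cong f ([x+y]+z≡[x+z]+y y t a))
                          (f-shift (y + a) t∈Fq)

      -- Δ x = Δ y forces D x = D y (apply D and cancel 1 − c), so
      -- d = x − y ∈ F_q, and then Δ x = Δ y + (1 − c)·B·d forces d = 0.
      Δ-injective : ∀ x y → Δ x ≡ Δ y → x ≡ y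
      Δ-injective x y Δx≡Δy = begin
        x          ≡⟨ x≡y+d ⟩
        y + d      ≡⟨ cong (y +_) d≡0 ⟩
        y + 0#     ≡⟨ +-identityʳ y ⟩
        y          ∎
        where
        Dfx≡Dfy : D (f x) ≡ D (f y)
        Dfx≡Dfy = *-cancelˡ-≢0 (1# - c) 1-c≢0
          (∙-cancelʳ (D (f a)) _ _ (trans (sym (D∘Δ x)) (trans (cong D Δx≡Δy) (D∘Δ y))))
        d = x - y
        x≡y+d : x ≡ y + d
        x≡y+d = trans (sym ([y-x]+x≡y y x)) (+-comm d y)
        d∈Fq : InFq d
        d∈Fq = D≡⇒difference-InFq (D∘f-reflects Dfx≡Dfy)
        d≡0 : d ≡ 0#
        d≡0 = *-≡0⇒≡0 B≢0 (*-≡0⇒≡0 1-c≢0 (∙-cancelˡ (Δ y) _ _ (begin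
          Δ y + (1# - c) * (B * d)   ≡⟨ sym (Δ-shift y d∈Fq) ⟩
          Δ (y + d)                  ≡⟨ cong Δ (sym x≡y+d) ⟩
          Δ x                        ≡⟨ Δx≡Δy ⟩
          Δ y                        ≡⟨ sym (+-identityʳ (Δ y)) ⟩
          Δ y + 0#                   ∎)))

    pcn-criterion : ∀ c → InFq c → c ≢ 1# → IsPcN F c f
    pcn-criterion c c∈Fq c≢1 a b _ = #solutions≤1 Δ Δ-injective b
      where open Derivative c c∈Fq c≢1 a

  -- The maps of Theorem 3.10:  f(x) = b·L_as(x) + g(D x)^s  with b and the
  -- coefficients as in F_q, g(J) ⊆ J, and s = k + l for additive powers k, l.
  module Theorem310Maps (as : List Carrier) (as∈Fq : All InFq as)
                         (g : List Carrier) (g-J : ∀ y → InJ F q y → InJ F q (evalPoly F g y))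
                         (b : Carrier) (b∈Fq : InFq b)
                         (s k l : ℕ) (k-additive : Additive k) (l-additive : Additive l) (s≡k+l : s ≡ k ℕ.+ l) where
    φ ψ f : Carrier → Carrier
    φ = evalLin F q as
    ψ z = evalPoly F g (D z) ^ s
    f = f3p10 F q as g b s

    -- g(D z) = D u for some u, so g(D z)^s = D(u^k)·D(u^l) ∈ F_q.
    ψ∈Fq : ∀ z → InFq (ψ z)
    ψ∈Fq z with g-J (D z) (z , refl)
    ... | u , gDz≡Du = subst InFq (sym ψz≡) (J-product-InFq (u ^ k) (u ^ l))
      where
      ψz≡ : ψ z ≡ D (u ^ k) * D (u ^ l)
      ψz≡ = begin
        evalPoly F g (D z) ^ s                ≡⟨ cong₂ _^_ gDz≡Du s≡k+l ⟩
        D u ^ (k ℕ.+ l)                       ≡⟨ ^-+ (D u) k l ⟩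
        D u ^ k * D u ^ l                     ≡⟨ cong₂ _*_ (D-^ k k-additive u) (D-^ l l-additive u) ⟩
        D (u ^ k) * D (u ^ l)                 ∎

    D∘f : ∀ z → D (f z) ≡ b * φ (D z)
    D∘f z = begin
      D (b * φ z + ψ z)          ≡⟨ D-+ (b * φ z) (ψ z) ⟩
      D (b * φ z) + D (ψ z)      ≡⟨ cong₂ _+_ (D-scalar (φ z) b∈Fq) (InFq⇒D≡0 (ψ∈Fq z)) ⟩
      b * D (φ z) + 0#           ≡⟨ +-identityʳ _ ⟩
      b * D (φ z)                ≡⟨ cong (b *_) (D-lin as∈Fq z) ⟩
      b * φ (D z)                ∎

    D∘f-additive : ∀ x y → D (f (x + y)) ≡ D (f x) + D (f y)
    D∘f-additive x y = begin
      D (f (x + y))              ≡⟨ D∘f (x + y) ⟩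
      b * φ (D (x + y))          ≡⟨ cong (λ u → b * φ u) (D-+ x y) ⟩
      b * φ (D x + D y)          ≡⟨ cong (b *_) (lin-+ as (D x) (D y)) ⟩
      b * (φ (D x) + φ (D y))    ≡⟨ distribˡ b _ _ ⟩
      b * φ (D x) + b * φ (D y)  ≡⟨ sym (cong₂ _+_ (D∘f x) (D∘f y)) ⟩
      D (f x) + D (f y)          ∎

    f-shift : ∀ z {t} → InFq t → f (z + t) ≡ f z + (b * φ 1#) * t
    f-shift z {t} t∈Fq = begin
      b * φ (z + t) + ψ (z + t)            ≡⟨ cong₂ (λ u v → b * u + evalPoly F g v ^ s)
                                                    (trans (lin-+ as z t) (cong (φ z +_) (lin-InFq as t∈Fq))) (D-shift z t∈Fq) ⟩
      b * (φ z + φ 1# * t) + ψ z           ≡⟨ cong (_+ ψ z) (distribˡ b (φ z) (φ 1# * t)) ⟩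
      (b * φ z + b * (φ 1# * t)) + ψ z     ≡⟨ [x+y]+z≡[x+z]+y _ _ _ ⟩
      (b * φ z + ψ z) + b * (φ 1# * t)     ≡⟨ cong (f z +_) (sym (*-assoc b (φ 1#) t)) ⟩
      f z + (b * φ 1#) * t                 ∎

    φ1∈Fq : InFq (φ 1#)
    φ1∈Fq = trans (lin-^q as∈Fq 1#) (cong φ (1^ q))

    injective⇒PcN : (∀ {x y} → f x ≡ f y → x ≡ y) → ∀ c → InFq c → c ≢ 1# → IsPcN F c f
    injective⇒PcN f-injective =
      PcNCriterion.pcn-criterion f f-injective D∘f-additive (b * φ 1#) (InFq-* b∈Fq φ1∈Fq) f-shift

-- The natural-number operators of the statement are opened only here, where
-- no field operators are in scope.
open import Data.Nat using (_^_; _≤_; _∸_; _*_; _+_)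

theorem3p10 : (p m : ℕ) → Prime p → 1 ≤ m →
    (F : FiniteField ((p ^ m) ^ 2)) →
    (g : List (FiniteField.Carrier F)) →
    (∀ y → InJ F (p ^ m) y → InJ F (p ^ m) (evalPoly F g y)) →
    (as : List (FiniteField.Carrier F)) → All (InSubfield F (p ^ m)) as →
    (s : ℕ) → (∃₂ λ h k → 1 ≤ h × h ≤ k × k ≤ 2 * m ∸ 1 × s ≡ p ^ h + p ^ k) →
    (b : FiniteField.Carrier F) → InSubfield F (p ^ m) b → b ≢ FiniteField.0# F →
    IsPermutation F (f3p10 F (p ^ m) as g b s) →
    (c : FiniteField.Carrier F) → InSubfield F (p ^ m) c → c ≢ FiniteField.1# F →
    IsPcN F c (f3p10 F (p ^ m) as g b s)
theorem3p10 p m p-prime _ F g g-J as as∈Fq s (h , k , _ , _ , _ , s≡pʰ+pᵏ) b b∈Fq _ f-bijective =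
  injective⇒PcN (proj₁ f-bijective)
  where
  open FieldFacts F using (Additive; prime-power-additive)
  open FiniteFieldFacts F using (characteristic; ^q-involutive)

  q : ℕ
  q = p ^ m

  -- F has order p^(2m), hence characteristic p, so all p-power maps are additive.
  power-additive : ∀ e → Additive (p ^ e)
  power-additive = prime-power-additive p-prime (characteristic p (m * 2) (ℕP.^-*-assoc p m 2))

  open QDifference F q (power-additive m) (^q-involutive q (cong (q *_) (ℕP.*-identityʳ q)))
  open Theorem310Maps as as∈Fq g g-J b b∈Fq s (p ^ h) (p ^ k) (power-additive h) (power-additive k) s≡pʰ+pᵏ
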